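{- (1) Every constant functor on $\mathbf{Nom}$ has a sub-strength. (2) The identity functor on $\mathbf{Nom}$ has a sub-strength. (3) The class of endofunctors on $\mathbf{Nom}$ having a sub-strength is closed under finite products, arbitrary coproducts, and functor composition.
   Context: $\mathbf{Nom}$ is the category of nominal sets (sets with an action of the group of finite permutations of a fixed infinite set $\mathbb V$ of atoms in which every element $x$ has a finite support; $\mathrm{supp}(x)$ is the least support) and equivariant maps. For nominal sets $X,Y$, $X<Y=\{(x,y)\in X\times Y\mid\mathrm{supp}(x)\subseteq\mathrm{supp}(y)\}$, with projection $\mathrm{outl}:X<Y\to X$. A sub-strength of $F:\mathbf{Nom}\to\mathbf{Nom}$ is a family of equivariant maps $s_{X,Y}:FX<Y\to F(X<Y)$, indexed by nominal sets $X,Y$ and not necessarily natural, such that $F\mathrm{outl}\circ s_{X,Y}=\mathrm{outl}$. -}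

module Defs where

open import Data.Nat using (ℕ; _≟_)
open import Data.Bool using (T)
open import Data.Bool.Properties using (T-irrelevant)
open import Data.Unit using (⊤; tt)
open import Data.Product using (Σ; ∃; _×_; _,_; proj₁; proj₂)
open import Data.Sum using (inj₁; inj₂)
open import Data.List using (List; []; _∷_; _++_; map; reverse; _∷ʳ_)
open import Data.List.Properties using (unfold-reverse; ++-assoc)
open import Data.List.Membership.Propositional using (_∈_)
open import Data.List.Membership.Propositional.Properties using (∈-map⁺; ∈-map⁻; ∈-++⁺ˡ; ∈-++⁺ʳ; ∈-++⁻)
open import Data.List.Membership.DecPropositional _≟_ using (_∈?_)
open import Data.List.Relation.Unary.All as All using (All; all?)
open import Relation.Nullary using (yes; no; Dec)
open import Relation.Nullary.Decidable using (True; toWitness; fromWitness)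
open import Relation.Binary.PropositionalEquality

-- Atoms: 𝕍 = ℕ.  Finite permutations of 𝕍, represented by finite lists of
-- transpositions (every finite permutation is such a product); two
-- representations denote the same group element iff they agree pointwise.

swap : ℕ → ℕ → ℕ → ℕ
swap a b c with c ≟ a
... | yes _ = b
... | no _ with c ≟ b
...   | yes _ = a
...   | no _ = c

swap-invol : ∀ a b c → swap a b (swap a b c) ≡ c
swap-invol a b c with c ≟ a
swap-invol a b c | yes c≡a with b ≟ a
... | yes b≡a = trans b≡a (sym c≡a)
... | no _ with b ≟ b
...   | yes _ = sym c≡a
...   | no b≢b = ⊥-elim' (b≢b refl)
  where
  open import Data.Empty using (⊥-elim)
  ⊥-elim' : ∀ {A : Set} → _ → A
  ⊥-elim' = ⊥-elim
swap-invol a b c | no c≢a with c ≟ b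
swap-invol a b c | no c≢a | yes c≡b with a ≟ a
... | yes _ = sym c≡b
... | no a≢a = ⊥-elim (a≢a refl)
  where open import Data.Empty using (⊥-elim)
swap-invol a b c | no c≢a | no c≢b with c ≟ a
... | yes c≡a = ⊥-elim (c≢a c≡a)
  where open import Data.Empty using (⊥-elim)
... | no _ with c ≟ b
...   | yes c≡b = ⊥-elim (c≢b c≡b)
  where open import Data.Empty using (⊥-elim)
...   | no _ = refl

Perm : Set
Perm = List (ℕ × ℕ)

-- the bijection denoted by a permutation; (π ++ σ) means "first σ, then π"
perm : Perm → ℕ → ℕ
perm [] c = c
perm ((a , b) ∷ π) c = swap a b (perm π c)

perm-++ : ∀ π σ c → perm (π ++ σ) c ≡ perm π (perm σ c)
perm-++ [] σ c = refl
perm-++ ((a , b) ∷ π) σ c = cong (swap a b) (perm-++ π σ c)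

inv : Perm → Perm
inv = reverse

perm-inv-l : ∀ π c → perm (inv π) (perm π c) ≡ c
perm-inv-l [] c = refl
perm-inv-l ((a , b) ∷ π) c rewrite unfold-reverse (a , b) π
  | perm-++ (reverse π) ((a , b) ∷ []) (swap a b (perm π c))
  | swap-invol a b (perm π c) = perm-inv-l π c

perm-inv-r : ∀ π c → perm π (perm (inv π) c) ≡ c
perm-inv-r [] c = refl
perm-inv-r ((a , b) ∷ π) c rewrite unfold-reverse (a , b) π
  | perm-++ (reverse π) ((a , b) ∷ []) c
  | perm-inv-r π (swap a b c) = swap-invol a b c

Supports : {A : Set} → (Perm → A → A) → List ℕ → A → Set
Supports act S x = ∀ π → (∀ a → a ∈ S → perm π a ≡ a) → act π x ≡ x

record Nom : Set₁ where
  field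
    Carrier  : Set
    act      : Perm → Carrier → Carrier
    -- the action is an action of the group (well defined on group elements)
    act-resp : ∀ {π σ} → (∀ a → perm π a ≡ perm σ a) → ∀ x → act π x ≡ act σ x
    act-id   : ∀ x → act [] x ≡ x
    act-∘    : ∀ π σ x → act (π ++ σ) x ≡ act π (act σ x)
    supp           : Carrier → List ℕ
    supp-supports  : ∀ x → Supports act (supp x) x
    supp-least     : ∀ x S → Supports act S x → ∀ a → a ∈ supp x → a ∈ S

open Nom public

record _⇒_ (X Y : Nom) : Set where
  field
    fun   : Carrier X → Carrier Y
    equiv : ∀ π x → fun (act X π x) ≡ act Y π (fun x)

open _⇒_ public

idN : ∀ {X} → X ⇒ X
idN = record { fun = λ x → x ; equiv = λ _ _ → refl }

_∘N_ : ∀ {X Y Z} → Y ⇒ Z → X ⇒ Y → X ⇒ Z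
_∘N_ {X} {Y} {Z} g f = record
  { fun = λ x → fun g (fun f x)
  ; equiv = λ π x → trans (cong (fun g) (equiv f π x)) (equiv g π (fun f x)) }

module _ (X : Nom) where
  private
    _·_ = act X

  supports-act : ∀ {S x} π → Supports (act X) S x →
                 Supports (act X) (map (perm π) S) (π · x)
  supports-act {S} {x} π hS σ fix =
    begin
      σ · (π · x)         ≡⟨ sym (act-∘ X σ π x) ⟩
      (σ ++ π) · x        ≡⟨ act-resp X eq x ⟩
      (π ++ τ) · x        ≡⟨ act-∘ X π τ x ⟩
      π · (τ · x)         ≡⟨ cong (π ·_) (hS τ τfix) ⟩
      π · x ∎
    where
    open ≡-Reasoning
    τ = inv π ++ (σ ++ π)
    τ-eq : ∀ a → perm τ a ≡ perm (inv π) (perm σ (perm π a))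
    τ-eq a = trans (perm-++ (inv π) (σ ++ π) a) (cong (perm (inv π)) (perm-++ σ π a))
    τfix : ∀ a → a ∈ S → perm τ a ≡ a
    τfix a a∈ = trans (τ-eq a)
      (trans (cong (perm (inv π)) (fix (perm π a) (∈-map⁺ (perm π) a∈))) (perm-inv-l π a))
    eq : ∀ a → perm (σ ++ π) a ≡ perm (π ++ τ) a
    eq a = trans (perm-++ σ π a) (sym (trans (perm-++ π τ a)
             (trans (cong (perm π) (τ-eq a)) (perm-inv-r π (perm σ (perm π a))))))

  supp-act⊆ : ∀ π x a → a ∈ supp X (π · x) → a ∈ map (perm π) (supp X x)
  supp-act⊆ π x = supp-least X (π · x) _ (supports-act π (supp-supports X x))

  inv-act : ∀ π x → inv π · (π · x) ≡ x
  inv-act π x = trans (sym (act-∘ X (inv π) π x))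
    (trans (act-resp X (λ a → trans (perm-++ (inv π) π a) (perm-inv-l π a)) x) (act-id X x))

  supp-act⊇ : ∀ π x a → a ∈ supp X x → perm π a ∈ supp X (π · x)
  supp-act⊇ π x a a∈ with ∈-map⁻ (perm (inv π)) (supp-act⊆ (inv π) (π · x) a (subst (λ z → a ∈ supp X z) (sym (inv-act π x)) a∈))
  ... | c , c∈ , a≡ = subst (_∈ supp X (π · x)) (sym (trans (cong (perm π) a≡) (perm-inv-r π c))) c∈

-- decidable inclusion of finite sets of atoms (proof-irrelevant)
_⊆ₐ_ : List ℕ → List ℕ → Set
xs ⊆ₐ ys = True (all? (_∈? ys) xs)

⊆ₐ-act : ∀ X Y π {x y} → supp X x ⊆ₐ supp Y y →
         supp X (act X π x) ⊆ₐ supp Y (act Y π y)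
⊆ₐ-act X Y π {x} {y} p = fromWitness (All.tabulate h)
  where
  w = toWitness p
  h : ∀ {a} → a ∈ supp X (act X π x) → a ∈ supp Y (act Y π y)
  h {a} a∈ with ∈-map⁻ (perm π) (supp-act⊆ X π x a a∈)
  ... | b , b∈ , refl = supp-act⊇ Y π y b (All.lookup w b∈)

module _ (X Y : Nom) where
  infix 5 _<N_
  LtCarrier : Set
  LtCarrier = Σ (Carrier X × Carrier Y) λ p → supp X (proj₁ p) ⊆ₐ supp Y (proj₂ p)

  lt≡ : ∀ {x x' y y'} {p : supp X x ⊆ₐ supp Y y} {q : supp X x' ⊆ₐ supp Y y'} →
        x ≡ x' → y ≡ y' → _≡_ {A = LtCarrier} ((x , y) , p) ((x' , y') , q)
  lt≡ {p = p} {q} refl refl = cong ((_ , _) ,_) (T-irrelevant p q)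

  _<N_ : Nom
  _<N_ = record
    { Carrier = LtCarrier
    ; act = λ π z → ((act X π (proj₁ (proj₁ z)) , act Y π (proj₂ (proj₁ z))) , ⊆ₐ-act X Y π (proj₂ z))
    ; act-resp = λ e z → lt≡ (act-resp X e _) (act-resp Y e _)
    ; act-id = λ z → lt≡ (act-id X _) (act-id Y _)
    ; act-∘ = λ π σ z → lt≡ (act-∘ X π σ _) (act-∘ Y π σ _)
    ; supp = λ z → supp Y (proj₂ (proj₁ z))
    ; supp-supports = λ { ((x , y) , p) π fix →
        lt≡ (supp-supports X x π (λ a a∈ → fix a (All.lookup (toWitness p) a∈)))
            (supp-supports Y y π fix) }
    ; supp-least = λ { ((x , y) , p) S hS →
        supp-least Y y S (λ π fix → cong (λ z → proj₂ (proj₁ z)) (hS π fix)) }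
    }


outl : ∀ X Y → (X <N Y) ⇒ X
outl X Y = record { fun = λ z → proj₁ (proj₁ z) ; equiv = λ _ _ → refl }

record Functor : Set₁ where
  field
    F₀      : Nom → Nom
    F₁      : ∀ {X Y} → X ⇒ Y → F₀ X ⇒ F₀ Y
    F-resp  : ∀ {X Y} {f g : X ⇒ Y} → (∀ x → fun f x ≡ fun g x) →
              ∀ x → fun (F₁ f) x ≡ fun (F₁ g) x
    F-id    : ∀ {X} x → fun (F₁ (idN {X})) x ≡ x
    F-∘     : ∀ {X Y Z} (g : Y ⇒ Z) (f : X ⇒ Y) x →
              fun (F₁ (g ∘N f)) x ≡ fun (F₁ g) (fun (F₁ f) x)

open Functor public

-- sub-strength: equivariant (not necessarily natural) s_{X,Y} : FX < Y → F(X < Y)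
-- with F outl ∘ s = outl
SubStrength : Functor → Set₁
SubStrength F =
  Σ (∀ X Y → (F₀ F X <N Y) ⇒ F₀ F (X <N Y)) λ s →
    ∀ X Y z → fun (F₁ F (outl X Y)) (fun (s X Y) z) ≡ fun (outl (F₀ F X) Y) z

𝟙N : Nom
𝟙N = record
  { Carrier = ⊤ ; act = λ _ _ → tt ; act-resp = λ _ _ → refl ; act-id = λ _ → refl
  ; act-∘ = λ _ _ _ → refl ; supp = λ _ → [] ; supp-supports = λ _ _ _ → refl
  ; supp-least = λ _ _ _ _ () }

_×N_ : Nom → Nom → Nom
X ×N Y = record
  { Carrier = Carrier X × Carrier Y
  ; act = λ π p → act X π (proj₁ p) , act Y π (proj₂ p)
  ; act-resp = λ e p → cong₂ _,_ (act-resp X e _) (act-resp Y e _)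
  ; act-id = λ p → cong₂ _,_ (act-id X _) (act-id Y _)
  ; act-∘ = λ π σ p → cong₂ _,_ (act-∘ X π σ _) (act-∘ Y π σ _)
  ; supp = λ p → supp X (proj₁ p) ++ supp Y (proj₂ p)
  ; supp-supports = λ { (x , y) π fix → cong₂ _,_
      (supp-supports X x π (λ a a∈ → fix a (∈-++⁺ˡ a∈)))
      (supp-supports Y y π (λ a a∈ → fix a (∈-++⁺ʳ (supp X x) a∈))) }
  ; supp-least = λ { (x , y) S hS a a∈ → h x y S hS a (∈-++⁻ (supp X x) a∈) }
  }
  where
  open import Data.Sum using (_⊎_)
  h : ∀ x y S → Supports (λ π p → act X π (proj₁ p) , act Y π (proj₂ p)) S (x , y) →
      ∀ a → a ∈ supp X x ⊎ a ∈ supp Y y → a ∈ S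
  h x y S hS a (inj₁ a∈) = supp-least X x S (λ π fix → cong proj₁ (hS π fix)) a a∈
  h x y S hS a (inj₂ a∈) = supp-least Y y S (λ π fix → cong proj₂ (hS π fix)) a a∈

ΣN : (I : Set) → (I → Nom) → Nom
ΣN I X = record
  { Carrier = Σ I λ i → Carrier (X i)
  ; act = λ π p → proj₁ p , act (X (proj₁ p)) π (proj₂ p)
  ; act-resp = λ { e (i , x) → cong (i ,_) (act-resp (X i) e x) }
  ; act-id = λ { (i , x) → cong (i ,_) (act-id (X i) x) }
  ; act-∘ = λ { π σ (i , x) → cong (i ,_) (act-∘ (X i) π σ x) }
  ; supp = λ p → supp (X (proj₁ p)) (proj₂ p)
  ; supp-supports = λ { (i , x) π fix → cong (i ,_) (supp-supports (X i) x π fix) }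
  ; supp-least = λ { (i , x) S hS → supp-least (X i) x S (λ π fix → h i x π (hS π fix)) }
  }
  where
  h : ∀ i x π {y} → _≡_ {A = Σ I λ i → Carrier (X i)} (i , y) (i , x) → y ≡ x
  h i x π refl = refl

ConstF : Nom → Functor
ConstF A = record
  { F₀ = λ _ → A ; F₁ = λ _ → idN ; F-resp = λ _ _ → refl
  ; F-id = λ _ → refl ; F-∘ = λ _ _ _ → refl }

IdF : Functor
IdF = record
  { F₀ = λ X → X ; F₁ = λ f → f ; F-resp = λ e → e
  ; F-id = λ _ → refl ; F-∘ = λ _ _ _ → refl }

_∘F_ : Functor → Functor → Functor
G ∘F F = record
  { F₀ = λ X → F₀ G (F₀ F X)
  ; F₁ = λ f → F₁ G (F₁ F f)
  ; F-resp = λ e → F-resp G (F-resp F e)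
  ; F-id = λ x → trans (F-resp G (F-id F) x) (F-id G x)
  ; F-∘ = λ g f x → trans (F-resp G (F-∘ F g f) x) (F-∘ G (F₁ F g) (F₁ F f) x)
  }

_×F_ : Functor → Functor → Functor
F ×F G = record
  { F₀ = λ X → F₀ F X ×N F₀ G X
  ; F₁ = λ f → record
      { fun = λ p → fun (F₁ F f) (proj₁ p) , fun (F₁ G f) (proj₂ p)
      ; equiv = λ π p → cong₂ _,_ (equiv (F₁ F f) π _) (equiv (F₁ G f) π _) }
  ; F-resp = λ e p → cong₂ _,_ (F-resp F e _) (F-resp G e _)
  ; F-id = λ p → cong₂ _,_ (F-id F _) (F-id G _)
  ; F-∘ = λ g f p → cong₂ _,_ (F-∘ F g f _) (F-∘ G g f _)
  }

-- nullary product of functors (the terminal functor)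
𝟙F : Functor
𝟙F = ConstF 𝟙N

ΣF : (I : Set) → (I → Functor) → Functor
ΣF I F = record
  { F₀ = λ X → ΣN I (λ i → F₀ (F i) X)
  ; F₁ = λ f → record
      { fun = λ p → proj₁ p , fun (F₁ (F (proj₁ p)) f) (proj₂ p)
      ; equiv = λ { π (i , x) → cong (i ,_) (equiv (F₁ (F i) f) π x) } }
  ; F-resp = λ { e (i , x) → cong (i ,_) (F-resp (F i) e x) }
  ; F-id = λ { (i , x) → cong (i ,_) (F-id (F i) x) }
  ; F-∘ = λ { g f (i , x) → cong (i ,_) (F-∘ (F i) g f x) }
  }

-- For F × G, the support of a pair
-- contains the supports of both components, so (a , b) < y splits into a < y and
-- b < y; X < Y distributes over coproducts in X; for G ∘ F one takes
-- G s^F ∘ s^G_{FX,Y}, and the law F outl ∘ s = outl transfers along functoriality of G.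
module Submission where

open import Defs
open import Data.Product using (_×_; _,_; proj₁; proj₂)
open import Data.List using (List; _++_)
open import Data.List.Membership.Propositional.Properties using (∈-++⁺ˡ; ∈-++⁺ʳ)
import Data.List.Relation.Unary.All as All
open import Data.Nat using (ℕ)
open import Relation.Nullary.Decidable using (toWitness; fromWitness)
open import Relation.Binary.PropositionalEquality using (_≡_; refl; cong; cong₂; module ≡-Reasoning)

⊆ₐ-trans : {xs ys zs : List ℕ} → xs ⊆ₐ ys → ys ⊆ₐ zs → xs ⊆ₐ zs
⊆ₐ-trans p q = fromWitness (All.map (All.lookup (toWitness q)) (toWitness p))

⊆ₐ-++ˡ : (xs ys : List ℕ) → xs ⊆ₐ (xs ++ ys)
⊆ₐ-++ˡ xs ys = fromWitness (All.tabulate ∈-++⁺ˡ)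

⊆ₐ-++ʳ : (xs ys : List ℕ) → ys ⊆ₐ (xs ++ ys)
⊆ₐ-++ʳ xs ys = fromWitness (All.tabulate (∈-++⁺ʳ xs))

<N-mapˡ : ∀ {X X'} Y (f : X ⇒ X') → (∀ x → supp X' (fun f x) ⊆ₐ supp X x) →
          (X <N Y) ⇒ (X' <N Y)
<N-mapˡ {X} {X'} Y f shrink = record
  { fun = λ { ((x , y) , p) → (fun f x , y) , ⊆ₐ-trans (shrink x) p }
  ; equiv = λ { π ((x , y) , p) → lt≡ X' Y (equiv f π x) refl } }

π₁N : ∀ {X Y} → (X ×N Y) ⇒ X
π₁N = record { fun = proj₁ ; equiv = λ _ _ → refl }

π₂N : ∀ {X Y} → (X ×N Y) ⇒ Y
π₂N = record { fun = proj₂ ; equiv = λ _ _ → refl }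

⟨_,_⟩N : ∀ {Z X Y} → Z ⇒ X → Z ⇒ Y → Z ⇒ (X ×N Y)
⟨ f , g ⟩N = record
  { fun = λ z → fun f z , fun g z
  ; equiv = λ π z → cong₂ _,_ (equiv f π z) (equiv g π z) }

ΣN-map : ∀ {I} {X X' : I → Nom} → (∀ i → X i ⇒ X' i) → ΣN I X ⇒ ΣN I X'
ΣN-map f = record
  { fun = λ { (i , x) → i , fun (f i) x }
  ; equiv = λ { π (i , x) → cong (i ,_) (equiv (f i) π x) } }

<N-distribˡ-ΣN : ∀ I (X : I → Nom) Y → (ΣN I X <N Y) ⇒ ΣN I (λ i → X i <N Y)
<N-distribˡ-ΣN I X Y = record
  { fun = λ { (((i , x) , y) , p) → i , ((x , y) , p) }
  ; equiv = λ { π (((i , x) , y) , p) → cong (i ,_) (lt≡ (X i) Y refl refl) } }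

constant-subStrength : (A : Nom) → SubStrength (ConstF A)
constant-subStrength A = (λ X Y → outl A Y) , (λ X Y z → refl)

identity-subStrength : SubStrength IdF
identity-subStrength = (λ X Y → idN) , (λ X Y z → refl)

×F-subStrength : (F G : Functor) → SubStrength F → SubStrength G → SubStrength (F ×F G)
×F-subStrength F G (sF , cF) (sG , cG) = s , c
  where
  module _ (X Y : Nom) where
    s : (F₀ (F ×F G) X <N Y) ⇒ F₀ (F ×F G) (X <N Y)
    s = ⟨ sF X Y ∘N <N-mapˡ Y π₁N (λ { (a , b) → ⊆ₐ-++ˡ (supp (F₀ F X) a) (supp (F₀ G X) b) })
        , sG X Y ∘N <N-mapˡ Y π₂N (λ { (a , b) → ⊆ₐ-++ʳ (supp (F₀ F X) a) (supp (F₀ G X) b) }) ⟩N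
    c : ∀ z → fun (F₁ (F ×F G) (outl X Y)) (fun s z) ≡ fun (outl (F₀ (F ×F G) X) Y) z
    c (((a , b) , y) , p) = cong₂ _,_ (cF X Y _) (cG X Y _)

ΣF-subStrength : (I : Set) (F : I → Functor) → ((i : I) → SubStrength (F i)) →
                 SubStrength (ΣF I F)
ΣF-subStrength I F S = s , c
  where
  module _ (X Y : Nom) where
    s : (F₀ (ΣF I F) X <N Y) ⇒ F₀ (ΣF I F) (X <N Y)
    s = ΣN-map (λ i → proj₁ (S i) X Y) ∘N <N-distribˡ-ΣN I (λ i → F₀ (F i) X) Y
    c : ∀ z → fun (F₁ (ΣF I F) (outl X Y)) (fun s z) ≡ fun (outl (F₀ (ΣF I F) X) Y) z
    c (((i , a) , y) , p) = cong (i ,_) (proj₂ (S i) X Y ((a , y) , p))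

∘F-subStrength : (F G : Functor) → SubStrength F → SubStrength G → SubStrength (G ∘F F)
∘F-subStrength F G (sF , cF) (sG , cG) = s , c
  where
  s : ∀ X Y → (F₀ (G ∘F F) X <N Y) ⇒ F₀ (G ∘F F) (X <N Y)
  s X Y = F₁ G (sF X Y) ∘N sG (F₀ F X) Y
  c : ∀ X Y z → fun (F₁ (G ∘F F) (outl X Y)) (fun (s X Y) z) ≡ fun (outl (F₀ (G ∘F F) X) Y) z
  c X Y z = begin
    fun (F₁ G (F₁ F (outl X Y))) (fun (F₁ G (sF X Y)) z')
      ≡⟨ F-∘ G (F₁ F (outl X Y)) (sF X Y) z' ⟨
    fun (F₁ G (F₁ F (outl X Y) ∘N sF X Y)) z'
      ≡⟨ F-resp G {f = F₁ F (outl X Y) ∘N sF X Y} {g = outl (F₀ F X) Y} (cF X Y) z' ⟩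
    fun (F₁ G (outl (F₀ F X) Y)) z'
      ≡⟨ cG (F₀ F X) Y z ⟩
    fun (outl (F₀ (G ∘F F) X) Y) z ∎
    where
    open ≡-Reasoning
    z' = fun (sG (F₀ F X) Y) z

lemma23 : ((A : Nom) → SubStrength (ConstF A))
    × SubStrength IdF
    × (SubStrength 𝟙F
    × ((F G : Functor) → SubStrength F → SubStrength G → SubStrength (F ×F G)))
    × ((I : Set) (F : I → Functor) → ((i : I) → SubStrength (F i)) → SubStrength (ΣF I F))
    × ((F G : Functor) → SubStrength F → SubStrength G → SubStrength (G ∘F F))
lemma23 = constant-subStrength
        , identity-subStrength
        , (constant-subStrength 𝟙N , ×F-subStrength)
        , ΣF-subStrength
        , ∘F-subStrength
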